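{- $F(\chi,1) = \{\text{claw}, \text{gem}, W_4, \text{butterfly}\}=F(\omega,1)$.
   Context: All graphs are finite and simple. The claw is $K_{1,3}$; the gem is the path $P_4$ together with an added vertex adjacent to all four path vertices; $W_4$ is the cycle $C_4$ together with an added vertex adjacent to all four cycle vertices; the butterfly is two triangles sharing exactly one vertex. $\Delta(H)$, $\omega(H)$, $\chi(H)$ denote maximum degree, clique number and chromatic number. For $k\in\mathbb{N}_0$: $\varOmega_k$ is the class of graphs $G$ such that every induced subgraph $H$ of $G$ (including $G$) satisfies $\Delta(H)\le\omega(H)+k-1$; $\varUpsilon_k$ is the class of graphs $G$ such that every induced subgraph $H$ of $G$ (including $G$) satisfies $\Delta(H)\le\chi(H)+k-1$. $F(\omega,k)$ (resp. $F(\chi,k)$) is the set of minimal forbidden induced subgraphs of $\varOmega_k$ (resp. $\varUpsilon_k$): graphs not in the class all of whose proper induced subgraphs are in the class (up to isomorphism). -}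

module Defs where

open import Data.Bool using (Bool; true; false; if_then_else_; _∧_; _∨_; not)
open import Data.Bool.Properties using (∨-comm)
open import Data.Nat using (ℕ; zero; suc; _+_; _≤_; _<_; _⊔_; _≡ᵇ_)
open import Data.Fin using (Fin; toℕ; _≟_)
open import Data.List using (List; []; _∷_; map; foldr; allFin)
open import Data.Nat.ListAction using (sum)
open import Data.Bool.ListAction using (any)
open import Data.Product using (Σ; _×_; _,_)
open import Data.Sum using (_⊎_)
open import Data.Empty using (⊥-elim)
open import Relation.Nullary using (¬_; does; yes; no)
open import Relation.Binary.PropositionalEquality using (_≡_; refl; sym; cong)
open import Function.Definitions using (Injective; Bijective)

record Graph (n : ℕ) : Set where
  field
    adj    : Fin n → Fin n → Bool
    irrefl : ∀ i → adj i i ≡ false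
    symm   : ∀ i j → adj i j ≡ adj j i
open Graph public

-- The subgraph of G induced by the image of an injective map f : Fin m → Fin n
-- (every induced subgraph of G is isomorphic to one of these, and conversely).
induced : ∀ {n m} → Graph n → (Fin m → Fin n) → Graph m
induced G f = record
  { adj    = λ i j → adj G (f i) (f j)
  ; irrefl = λ i → irrefl G (f i)
  ; symm   = λ i j → symm G (f i) (f j)
  }

_≅_ : ∀ {n m} → Graph n → Graph m → Set
_≅_ {n} {m} G H =
  Σ (Fin n → Fin m) λ f → Bijective _≡_ _≡_ f × (∀ i j → adj H (f i) (f j) ≡ adj G i j)

degree : ∀ {n} → Graph n → Fin n → ℕ
degree {n} G v = sum (map (λ u → if adj G v u then 1 else 0) (allFin n))

-- Δ(G) (equal to 0 for the graph with no vertices)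
Δ : ∀ {n} → Graph n → ℕ
Δ {n} G = foldr _⊔_ 0 (map (degree G) (allFin n))

HasClique : ∀ {n} → Graph n → ℕ → Set
HasClique {n} G s =
  Σ (Fin s → Fin n) λ f → Injective _≡_ _≡_ f × (∀ i j → ¬ i ≡ j → adj G (f i) (f j) ≡ true)

IsCliqueNumber : ∀ {n} → Graph n → ℕ → Set
IsCliqueNumber G w = HasClique G w × (∀ s → HasClique G s → s ≤ w)

Colourable : ∀ {n} → Graph n → ℕ → Set
Colourable {n} G c =
  Σ (Fin n → Fin c) λ col → ∀ i j → adj G i j ≡ true → ¬ col i ≡ col j

IsChromaticNumber : ∀ {n} → Graph n → ℕ → Set
IsChromaticNumber G c = Colourable G c × (∀ d → Colourable G d → c ≤ d)

-- The classes Ω_k and Υ_k.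
-- "Δ(H) ≤ ω(H) + k - 1" is written Δ(H) + 1 ≤ ω(H) + k (avoids truncated ∸).

InΩ : ℕ → ∀ {n} → Graph n → Set
InΩ k {n} G = ∀ m (f : Fin m → Fin n) → Injective _≡_ _≡_ f →
  ∀ w → IsCliqueNumber (induced G f) w → Δ (induced G f) + 1 ≤ w + k

InΥ : ℕ → ∀ {n} → Graph n → Set
InΥ k {n} G = ∀ m (f : Fin m → Fin n) → Injective _≡_ _≡_ f →
  ∀ c → IsChromaticNumber (induced G f) c → Δ (induced G f) + 1 ≤ c + k

MinimalForbidden : (∀ {n} → Graph n → Set) → ∀ {n} → Graph n → Set
MinimalForbidden P {n} G =
  ¬ P G × (∀ m (f : Fin m → Fin n) → Injective _≡_ _≡_ f → m < n → P (induced G f))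

edgeIn : List (ℕ × ℕ) → ℕ → ℕ → Bool
edgeIn es a b = any (λ { (x , y) → (x ≡ᵇ a) ∧ (y ≡ᵇ b) }) es

fromEdges : (n : ℕ) → List (ℕ × ℕ) → Graph n
fromEdges n es = record { adj = A ; irrefl = irr ; symm = sy }
  where
  E : Fin n → Fin n → Bool
  E i j = edgeIn es (toℕ i) (toℕ j) ∨ edgeIn es (toℕ j) (toℕ i)
  A : Fin n → Fin n → Bool
  A i j = if does (i ≟ j) then false else E i j
  irr : ∀ i → A i i ≡ false
  irr i with i ≟ i
  ... | yes _ = refl
  ... | no ¬p = ⊥-elim (¬p refl)
  sy : ∀ i j → A i j ≡ A j i
  sy i j with i ≟ j | j ≟ i
  ... | yes _ | yes _ = refl
  ... | yes p | no q = ⊥-elim (q (sym p))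
  ... | no p | yes q = ⊥-elim (p (sym q))
  ... | no _ | no _ = ∨-comm (edgeIn es (toℕ i) (toℕ j)) (edgeIn es (toℕ j) (toℕ i))

claw : Graph 4
claw = fromEdges 4 ((0 , 1) ∷ (0 , 2) ∷ (0 , 3) ∷ [])

gem : Graph 5
gem = fromEdges 5 ((0 , 1) ∷ (1 , 2) ∷ (2 , 3) ∷
                   (4 , 0) ∷ (4 , 1) ∷ (4 , 2) ∷ (4 , 3) ∷ [])

W4 : Graph 5
W4 = fromEdges 5 ((0 , 1) ∷ (1 , 2) ∷ (2 , 3) ∷ (3 , 0) ∷
                  (4 , 0) ∷ (4 , 1) ∷ (4 , 2) ∷ (4 , 3) ∷ [])

butterfly : Graph 5
butterfly = fromEdges 5 ((0 , 1) ∷ (0 , 2) ∷ (1 , 2) ∷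
                         (0 , 3) ∷ (0 , 4) ∷ (3 , 4) ∷ [])

InFourSet : ∀ {n} → Graph n → Set
InFourSet G = G ≅ claw ⊎ G ≅ gem ⊎ G ≅ W4 ⊎ G ≅ butterfly

-- In a graph with no induced claw, gem, W₄ or butterfly every vertex v has a
-- clique of size deg(v): two disjoint non-edges inside N(v) would induce, with
-- v, one of the four graphs, and three pairwise non-adjacent neighbours a claw,
-- so all non-edges of N(v) share one vertex c and (N(v) − c) ∪ {v} is a clique.
-- Hence Δ ≤ ω ≤ χ in every induced subgraph.  Conversely each of the four
-- graphs has Δ = ω + 1 = χ + 1, while its proper induced subgraphs contain none
-- of the four.
module Submission where

open import Defs
open import Data.Nat using (ℕ)
open import Data.Product using (_×_)
open import Function.Bundles using (_⇔_)

open import Data.Bool using (Bool; true; false; if_then_else_)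
open import Data.Bool.Properties using () renaming (_≟_ to _≟ᵇ_)
open import Data.Nat using (zero; suc; _+_; _≤_; _<_; _⊔_; z≤n; _<?_)
open import Data.Nat.Properties
  using (≤-refl; <-≤-trans; n≤1+n; n≮n; ≤-antisym; <⇒≱; ≮⇒≥; +-suc; +-monoˡ-≤; +-cancelʳ-≤;
         ⊔-lub)
open import Data.Nat.ListAction using (sum)
open import Data.Fin using (Fin; zero; suc; punchOut; #_)
open import Data.Fin.Properties
  using (_≟_; any?; all?; suc-injective; punchOut-injective; injective⇒≤)
open import Data.Vec.Functional using ([]; _∷_)
open import Data.List using (foldr; allFin; tabulate)
open import Data.List.Properties using (map-tabulate; map-cong; foldr-preservesᵇ)
open import Data.List.Relation.Unary.All.Properties using (map⁺; tabulate⁺)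
open import Data.Product using (Σ; ∃; ∃₂; _,_; proj₁; proj₂)
open import Data.Sum using (_⊎_; inj₁; inj₂)
import Data.Sum as Sum
open import Data.Empty using (⊥; ⊥-elim)
open import Function using (_∘_; id)
open import Function.Bundles using (mk⇔)
open import Function.Definitions using (Injective; Surjective)
open import Relation.Nullary using (¬_; Dec; yes; no; does; contradiction)
open import Relation.Nullary.Decidable
  using (_×-dec_; _→-dec_; _⊎-dec_; ¬?; map′; toSum; toWitness; toWitnessFalse; True;
         dec-true; dec-false; decidable-stable)
open import Relation.Binary.PropositionalEquality
  using (_≡_; _≢_; refl; sym; trans; cong; cong₂; subst; subst₂)

private
  variable
    k m n p q s : ℕ

infix 4 _↪_ _≈_

record _↪_ (T : Graph k) (G : Graph n) : Set where
  constructor embedding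
  field
    emb           : Fin k → Fin n
    emb-injective : Injective _≡_ _≡_ emb
    emb-adj       : ∀ i j → adj G (emb i) (emb j) ≡ adj T i j
open _↪_ using (emb)

_≈_ : Graph n → Graph n → Set
G ≈ H = ∀ i j → adj G i j ≡ adj H i j

≈-sym : {G H : Graph n} → G ≈ H → H ≈ G
≈-sym G≈H i j = sym (G≈H i j)

↪-trans : {X : Graph k} {H : Graph m} {G : Graph n} → X ↪ H → H ↪ G → X ↪ G
↪-trans (embedding f f-inj f-adj) (embedding g g-inj g-adj) =
  embedding (g ∘ f) (f-inj ∘ g-inj) λ i j → trans (g-adj (f i) (f j)) (f-adj i j)

↪-size : {X : Graph k} {G : Graph n} → X ↪ G → k ≤ n
↪-size (embedding _ f-inj _) = injective⇒≤ f-inj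

induced-↪ : (G : Graph n) {f : Fin m → Fin n} → Injective _≡_ _≡_ f → induced G f ↪ G
induced-↪ G {f} f-inj = embedding f f-inj λ _ _ → refl

≅⇒↪ : {G : Graph n} {H : Graph m} → G ≅ H → G ↪ H
≅⇒↪ (f , (f-inj , _) , f-adj) = embedding f f-inj f-adj

≅-sym : {G : Graph n} {H : Graph m} → G ≅ H → H ≅ G
≅-sym {G = G} {H} (f , (f-inj , f-surj) , f-adj) = g , (g-inj , g-surj) , g-adj
  where
  g : Fin _ → Fin _
  g y = proj₁ (f-surj y)
  f∘g : ∀ y → f (g y) ≡ y
  f∘g y = proj₂ (f-surj y) refl
  g-inj : Injective _≡_ _≡_ g
  g-inj {x} {y} gx≡gy = trans (sym (f∘g x)) (trans (cong f gx≡gy) (f∘g y))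
  g-surj : Surjective _≡_ _≡_ g
  g-surj x = f x , λ { refl → f-inj (f∘g (f x)) }
  g-adj : ∀ i j → adj G (g i) (g j) ≡ adj H i j
  g-adj i j = trans (sym (f-adj (g i) (g j))) (cong₂ (adj H) (f∘g i) (f∘g j))

↪⇒induced≅ : {X : Graph k} {G : Graph n} (e : X ↪ G) → induced G (emb e) ≅ X
↪⇒induced≅ (embedding _ _ f-adj) =
  id , (id , λ y → y , λ z≡y → z≡y) , λ i j → sym (f-adj i j)

injective⇒surjective : {f : Fin n → Fin n} → Injective _≡_ _≡_ f → Surjective _≡_ _≡_ f
injective⇒surjective {zero} f-inj ()
injective⇒surjective {suc n} {f} f-inj y with any? (λ x → f x ≟ y)
... | yes (x , fx≡y) = x , λ { refl → fx≡y }
... | no y∉f = contradiction (injective⇒≤ squeezed-inj) (n≮n n)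
  where
  y≢f : ∀ x → y ≢ f x
  y≢f x y≡fx = y∉f (x , sym y≡fx)
  -- Punching out the missed value y squeezes f into Fin n.
  squeezed-inj : Injective _≡_ _≡_ (λ x → punchOut (y≢f x))
  squeezed-inj eq = f-inj (punchOut-injective (y≢f _) (y≢f _) eq)

≅-of-equal-size : {X : Graph k} {G : Graph n} → k ≡ n → X ↪ G → G ≅ X
≅-of-equal-size {X = X} {G} refl (embedding f f-inj f-adj) =
  ≅-sym {G = X} {G} (f , (f-inj , injective⇒surjective f-inj) , f-adj)

any-map? : (P : (Fin k → Fin n) → Set) → (∀ f → Dec (P f)) →
           (∀ {f g} → (∀ i → f i ≡ g i) → P f → P g) → Dec (Σ (Fin k → Fin n) P)
any-map? {zero} P P? P-resp with P? []
... | yes p = yes (_ , p)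
... | no ¬p = no λ (f , pf) → ¬p (P-resp (λ ()) pf)
any-map? {suc k} P P? P-resp
  with any? (λ x → any-map? (λ g → P (x ∷ g)) (λ g → P? (x ∷ g))
                            (λ g≗h → P-resp λ { zero → refl ; (suc i) → g≗h i }))
... | yes (x , g , p) = yes (x ∷ g , p)
... | no ¬p =
  no λ (f , pf) → ¬p (f zero , f ∘ suc , P-resp (λ { zero → refl ; (suc i) → refl }) pf)

injective? : (f : Fin k → Fin n) → Dec (Injective _≡_ _≡_ f)
injective? f = map′ (λ inj → inj _ _) (λ inj _ _ → inj)
                    (all? λ i → all? λ j → (f i ≟ f j) →-dec (i ≟ j))

_↪?_ : (T : Graph k) (G : Graph n) → Dec (T ↪ G)
_↪?_ {k} {n} T G = map′ (λ (f , f-inj , f-adj) → embedding f f-inj f-adj)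
                        (λ (embedding f f-inj f-adj) → f , (λ {x y} → f-inj) , f-adj)
                        (any-map? IsEmbedding isEmbedding? resp)
  where
  IsEmbedding : (Fin k → Fin n) → Set
  IsEmbedding f = Injective _≡_ _≡_ f × (∀ i j → adj G (f i) (f j) ≡ adj T i j)
  isEmbedding? : ∀ f → Dec (IsEmbedding f)
  isEmbedding? f = injective? f ×-dec all? λ i → all? λ j → adj G (f i) (f j) ≟ᵇ adj T i j
  resp : ∀ {f g} → (∀ i → f i ≡ g i) → IsEmbedding f → IsEmbedding g
  resp {f} {g} f≗g (f-inj , f-adj) =
    (λ gi≡gj → f-inj (trans (f≗g _) (trans gi≡gj (sym (f≗g _))))) ,
    λ i j → subst₂ (λ x y → adj G x y ≡ adj T i j) (f≗g i) (f≗g j) (f-adj i j)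

∅ : Graph 0
∅ = record { adj = λ () ; irrefl = λ () ; symm = λ () }

addVertex : (Fin n → Bool) → Graph n → Graph (suc n)
addVertex {n} r G = record { adj = A ; irrefl = A-irrefl ; symm = A-symm }
  where
  A : Fin (suc n) → Fin (suc n) → Bool
  A zero    zero    = false
  A zero    (suc j) = r j
  A (suc i) zero    = r i
  A (suc i) (suc j) = adj G i j
  A-irrefl : ∀ i → A i i ≡ false
  A-irrefl zero    = refl
  A-irrefl (suc i) = irrefl G i
  A-symm : ∀ i j → A i j ≡ A j i
  A-symm zero    zero    = refl
  A-symm zero    (suc j) = refl
  A-symm (suc i) zero    = refl
  A-symm (suc i) (suc j) = symm G i j

∷-injective : ∀ {A : Set} {x : A} {f : Fin k → A} →
              (∀ i → x ≢ f i) → Injective _≡_ _≡_ f → Injective _≡_ _≡_ (x ∷ f)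
∷-injective x∉f f-inj {zero}  {zero}  _      = refl
∷-injective x∉f f-inj {zero}  {suc j} x≡fj   = contradiction x≡fj (x∉f j)
∷-injective x∉f f-inj {suc i} {zero}  fi≡x   = contradiction (sym fi≡x) (x∉f i)
∷-injective x∉f f-inj {suc i} {suc j} fi≡fj  = cong suc (f-inj fi≡fj)

∅-↪ : {G : Graph n} → ∅ ↪ G
∅-↪ = embedding (λ ()) (λ { {()} }) (λ ())

addVertex-↪ : {T : Graph k} {G : Graph n} {r : Fin k → Bool} (x : Fin n) (e : T ↪ G) →
              (∀ j → x ≢ emb e j) → (∀ j → adj G x (emb e j) ≡ r j) → addVertex r T ↪ G
addVertex-↪ {T = T} {G} {r} x (embedding f f-inj f-adj) x∉f x-row =
  embedding (x ∷ f) (∷-injective x∉f f-inj) adjacent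
  where
  adjacent : ∀ i j → adj G ((x ∷ f) i) ((x ∷ f) j) ≡ adj (addVertex r T) i j
  adjacent zero    zero    = irrefl G x
  adjacent zero    (suc j) = x-row j
  adjacent (suc i) zero    = trans (symm G (f i) x) (x-row i)
  adjacent (suc i) (suc j) = f-adj i j

adjacent⇒≢ : (G : Graph n) {x y : Fin n} → adj G x y ≡ true → x ≢ y
adjacent⇒≢ G xy refl = contradiction (trans (sym xy) (irrefl G _)) λ ()

HasForbidden : Graph n → Set
HasForbidden G = claw ↪ G ⊎ gem ↪ G ⊎ W4 ↪ G ⊎ butterfly ↪ G

hasForbidden? : (G : Graph n) → Dec (HasForbidden G)
hasForbidden? G = claw ↪? G ⊎-dec gem ↪? G ⊎-dec W4 ↪? G ⊎-dec butterfly ↪? G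

HasForbidden-↪ : {H : Graph m} {G : Graph n} → H ↪ G → HasForbidden H → HasForbidden G
HasForbidden-↪ e = Sum.map (λ x → ↪-trans x e) (Sum.map (λ x → ↪-trans x e)
                     (Sum.map (λ x → ↪-trans x e) (λ x → ↪-trans x e)))

decide-forbidden : {G : Graph n} → True (hasForbidden? G) → HasForbidden G
decide-forbidden = toWitness

-- Vertices v, a, b, c, d with v adjacent to the others, a ≁ b and c ≁ d;
-- the flags are the remaining adjacencies.
coneOverTwoNonEdges : Bool → Bool → Bool → Bool → Graph 5
coneOverTwoNonEdges ac ad bc bd =
  addVertex (true ∷ true ∷ true ∷ true ∷ [])
    (addVertex (false ∷ ac ∷ ad ∷ [])
      (addVertex (bc ∷ bd ∷ [])
        (addVertex (false ∷ [])
          (addVertex [] ∅))))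

coneOverTwoNonEdges-forbidden : ∀ ac ad bc bd → HasForbidden (coneOverTwoNonEdges ac ad bc bd)
coneOverTwoNonEdges-forbidden true  true  true  true  = decide-forbidden _
coneOverTwoNonEdges-forbidden true  true  true  false = decide-forbidden _
coneOverTwoNonEdges-forbidden true  true  false true  = decide-forbidden _
coneOverTwoNonEdges-forbidden true  true  false false = decide-forbidden _
coneOverTwoNonEdges-forbidden true  false true  true  = decide-forbidden _
coneOverTwoNonEdges-forbidden true  false true  false = decide-forbidden _
coneOverTwoNonEdges-forbidden true  false false true  = decide-forbidden _
coneOverTwoNonEdges-forbidden true  false false false = decide-forbidden _
coneOverTwoNonEdges-forbidden false true  true  true  = decide-forbidden _
coneOverTwoNonEdges-forbidden false true  true  false = decide-forbidden _
coneOverTwoNonEdges-forbidden false true  false true  = decide-forbidden _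
coneOverTwoNonEdges-forbidden false true  false false = decide-forbidden _
coneOverTwoNonEdges-forbidden false false true  true  = decide-forbidden _
coneOverTwoNonEdges-forbidden false false true  false = decide-forbidden _
coneOverTwoNonEdges-forbidden false false false true  = decide-forbidden _
coneOverTwoNonEdges-forbidden false false false false = decide-forbidden _

coneOverIndependentTriple : Graph 4
coneOverIndependentTriple =
  addVertex (true ∷ true ∷ true ∷ [])
    (addVertex (false ∷ false ∷ [])
      (addVertex (false ∷ [])
        (addVertex [] ∅)))

coneOverIndependentTriple-forbidden : HasForbidden coneOverIndependentTriple
coneOverIndependentTriple-forbidden = decide-forbidden _

count : (Fin n → Bool) → ℕ
count S = sum (tabulate (λ u → if S u then 1 else 0))

degree≡count : (G : Graph n) (v : Fin n) → degree G v ≡ count (adj G v)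
degree≡count G v = cong sum (map-tabulate id (λ u → if adj G v u then 1 else 0))

count-cong : {P Q : Fin n → Bool} → (∀ u → P u ≡ Q u) → count P ≡ count Q
count-cong {zero}  P≡Q = refl
count-cong {suc n} P≡Q =
  cong₂ (λ b c → (if b then 1 else 0) + c) (P≡Q zero) (count-cong (P≡Q ∘ suc))

count-insert : {P Q : Fin n → Bool} (c : Fin n) → P c ≡ true → Q c ≡ false →
               (∀ u → u ≢ c → P u ≡ Q u) → count P ≡ suc (count Q)
count-insert {suc n} {P} {Q} zero Pc Qc P≡Q rewrite Pc | Qc =
  cong suc (count-cong λ u → P≡Q (suc u) λ ())
count-insert {suc n} {P} {Q} (suc c) Pc Qc P≡Q rewrite P≡Q zero (λ ()) =
  trans (cong ((if Q zero then 1 else 0) +_)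
              (count-insert c Pc Qc λ u u≢c → P≡Q (suc u) (u≢c ∘ suc-injective)))
        (+-suc _ _)

enumerate : (S : Fin n → Bool) →
            Σ (Fin (count S) → Fin n) λ e → Injective _≡_ _≡_ e × (∀ i → S (e i) ≡ true)
enumerate {zero} S = (λ ()) , (λ { {()} }) , (λ ())
enumerate {suc n} S with S zero in S₀ | enumerate (S ∘ suc)
... | true  | e , e-inj , e∈S =
  zero ∷ suc ∘ e , ∷-injective (λ _ ()) (e-inj ∘ suc-injective) , e∈S′
  where
  e∈S′ : ∀ i → S ((zero ∷ suc ∘ e) i) ≡ true
  e∈S′ zero    = S₀
  e∈S′ (suc i) = e∈S i
... | false | e , e-inj , e∈S = suc ∘ e , e-inj ∘ suc-injective , e∈S

clique-of-set : (G : Graph n) (S : Fin n → Bool) →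
                (∀ a b → S a ≡ true → S b ≡ true → a ≢ b → adj G a b ≡ true) →
                HasClique G (count S)
clique-of-set G S pairwise with enumerate S
... | e , e-inj , e∈S = e , e-inj , λ i j i≢j → pairwise _ _ (e∈S i) (e∈S j) (i≢j ∘ e-inj)

clique≤colours : {G : Graph n} → HasClique G s → Colourable G q → s ≤ q
clique≤colours (K , _ , K-adj) (col , proper) = injective⇒≤ col∘K-inj
  where
  col∘K-inj : Injective _≡_ _≡_ (col ∘ K)
  col∘K-inj {i} {j} same = decidable-stable (i ≟ j) λ i≢j → proper _ _ (K-adj i j i≢j) same

ω≡χ≡ : {G : Graph n} → HasClique G q → Colourable G q →
       IsCliqueNumber G q × IsChromaticNumber G q
ω≡χ≡ {G = G} K col =
  (K , λ _ K′ → clique≤colours {G = G} K′ col) ,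
  (col , λ _ col′ → clique≤colours {G = G} K col′)

HasClique-cong : {G H : Graph n} → G ≈ H → HasClique G s → HasClique H s
HasClique-cong G≈H (K , K-inj , K-adj) =
  K , K-inj , λ i j i≢j → trans (sym (G≈H _ _)) (K-adj i j i≢j)

Colourable-cong : {G H : Graph n} → G ≈ H → Colourable G q → Colourable H q
Colourable-cong G≈H (col , proper) = col , λ i j ij → proper i j (trans (G≈H i j) ij)

Δ-lub : (G : Graph n) → (∀ v → degree G v ≤ q) → Δ G ≤ q
Δ-lub {q = q} G bound = foldr-preservesᵇ {P = _≤ q} ⊔-lub z≤n (map⁺ (tabulate⁺ bound))

degree-cong : {G H : Graph n} → G ≈ H → ∀ v → degree G v ≡ degree H v
degree-cong G≈H v =
  cong sum (map-cong (λ u → cong (λ b → if b then 1 else 0) (G≈H v u)) (allFin _))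

Δ-cong : {G H : Graph n} → G ≈ H → Δ G ≡ Δ H
Δ-cong {G = G} {H} G≈H = cong (foldr _⊔_ 0) (map-cong (degree-cong {G = G} {H} G≈H) (allFin _))

-- Neighbourhoods in graphs without claw, gem, W₄ and butterfly

module Neighbourhood (G : Graph n) (v : Fin n) (free : ¬ HasForbidden G) where

  Neighbour : Fin n → Set
  Neighbour a = adj G v a ≡ true

  Neighbour⇒≢ : ∀ {a} → Neighbour a → v ≢ a
  Neighbour⇒≢ = adjacent⇒≢ G

  NonEdge : Fin n → Fin n → Set
  NonEdge a b = Neighbour a × Neighbour b × a ≢ b × adj G a b ≡ false

  nonEdge? : ∀ a b → Dec (NonEdge a b)
  nonEdge? a b =
    adj G v a ≟ᵇ true ×-dec adj G v b ≟ᵇ true ×-dec ¬? (a ≟ b) ×-dec adj G a b ≟ᵇ false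

  NonEdge-sym : ∀ {a b} → NonEdge a b → NonEdge b a
  NonEdge-sym {a} {b} (va , vb , a≢b , ab) = vb , va , a≢b ∘ sym , trans (symm G b a) ab

  disjoint-non-edges : ∀ {a b c d} → NonEdge a b → NonEdge c d →
                       a ≢ c → a ≢ d → b ≢ c → b ≢ d → ⊥
  disjoint-non-edges {a} {b} {c} {d}
    (va , vb , a≢b , ab) (vc , vd , c≢d , cd) a≢c a≢d b≢c b≢d =
    free (HasForbidden-↪ cone (coneOverTwoNonEdges-forbidden _ _ _ _))
    where
    cone : coneOverTwoNonEdges (adj G a c) (adj G a d) (adj G b c) (adj G b d) ↪ G
    cone =
      addVertex-↪ v
        (addVertex-↪ a
          (addVertex-↪ b
            (addVertex-↪ c
              (addVertex-↪ d ∅-↪ (λ ()) (λ ()))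
              (λ { zero → c≢d }) (λ { zero → cd }))
            (λ { zero → b≢c ; (suc zero) → b≢d }) (λ { zero → refl ; (suc zero) → refl }))
          (λ { zero → a≢b ; (suc zero) → a≢c ; (suc (suc zero)) → a≢d })
          (λ { zero → ab ; (suc zero) → refl ; (suc (suc zero)) → refl }))
        (λ { zero → Neighbour⇒≢ va ; (suc zero) → Neighbour⇒≢ vb
           ; (suc (suc zero)) → Neighbour⇒≢ vc ; (suc (suc (suc zero))) → Neighbour⇒≢ vd })
        (λ { zero → va ; (suc zero) → vb ; (suc (suc zero)) → vc ; (suc (suc (suc zero))) → vd })

  non-edge-triangle : ∀ {a b c} → NonEdge a b → NonEdge a c → NonEdge b c → ⊥
  non-edge-triangle {a} {b} {c} (va , vb , a≢b , ab) (_ , vc , a≢c , ac) (_ , _ , b≢c , bc) =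
    free (HasForbidden-↪ cone coneOverIndependentTriple-forbidden)
    where
    cone : coneOverIndependentTriple ↪ G
    cone =
      addVertex-↪ v
        (addVertex-↪ a
          (addVertex-↪ b
            (addVertex-↪ c ∅-↪ (λ ()) (λ ()))
            (λ { zero → b≢c }) (λ { zero → bc }))
          (λ { zero → a≢b ; (suc zero) → a≢c }) (λ { zero → ab ; (suc zero) → ac }))
        (λ { zero → Neighbour⇒≢ va ; (suc zero) → Neighbour⇒≢ vb
           ; (suc (suc zero)) → Neighbour⇒≢ vc })
        (λ { zero → va ; (suc zero) → vb ; (suc (suc zero)) → vc })

  NonEdgeAvoiding : Fin n → Set
  NonEdgeAvoiding c = ∃₂ λ a b → NonEdge a b × a ≢ c × b ≢ c

  nonEdgeAvoiding? : ∀ c → Dec (NonEdgeAvoiding c)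
  nonEdgeAvoiding? c = any? λ a → any? λ b → nonEdge? a b ×-dec ¬? (a ≟ c) ×-dec ¬? (b ≟ c)

  non-edge-meets : ∀ {a b} → NonEdge a b → NonEdgeAvoiding a → ∃ λ y → NonEdge b y × y ≢ a
  non-edge-meets {a} {b} ab (x , y , xy , x≢a , y≢a) with x ≟ b | y ≟ b
  ... | yes refl | _        = y , xy , y≢a
  ... | no x≢b   | yes refl = x , NonEdge-sym xy , x≢a
  ... | no x≢b   | no y≢b   =
    ⊥-elim (disjoint-non-edges ab xy (x≢a ∘ sym) (y≢a ∘ sym) (x≢b ∘ sym) (y≢b ∘ sym))

  -- Since non-edges pairwise meet and form no triangle, they have a common vertex.
  non-edges-share-vertex : ∀ {a b} → NonEdge a b → ¬ NonEdgeAvoiding a ⊎ ¬ NonEdgeAvoiding b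
  non-edges-share-vertex {a} {b} ab@(_ , _ , a≢b , _) with nonEdgeAvoiding? a | nonEdgeAvoiding? b
  ... | no ¬avoid-a | _ = inj₁ ¬avoid-a
  ... | yes _       | no ¬avoid-b = inj₂ ¬avoid-b
  ... | yes avoid-a | yes avoid-b
    with non-edge-meets ab avoid-a | non-edge-meets (NonEdge-sym ab) avoid-b
  ... | y , by , y≢a | y′ , ay′ , y′≢b with y ≟ y′
  ...   | yes refl = ⊥-elim (non-edge-triangle ab ay′ by)
  ...   | no y≢y′  = ⊥-elim (disjoint-non-edges by ay′ (a≢b ∘ sym) (y′≢b ∘ sym) y≢a y≢y′)

  -- The clique is N(v) with c replaced by v.
  clique-around : ∀ c → Neighbour c → ¬ NonEdgeAvoiding c → HasClique G (degree G v)
  clique-around c vc ¬avoid =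
    subst (HasClique G) (sym size) (clique-of-set G K pairwise)
    where
    R K : Fin n → Bool
    R u = if does (u ≟ c) then false else adj G v u
    K u = if does (u ≟ v) then true else R u

    R-c : R c ≡ false
    R-c rewrite dec-true (c ≟ c) refl = refl
    R-≢ : ∀ u → u ≢ c → adj G v u ≡ R u
    R-≢ u u≢c rewrite dec-false (u ≟ c) u≢c = refl
    R-v : R v ≡ false
    R-v with v ≟ c
    ... | yes _ = refl
    ... | no  _ = irrefl G v
    K-v : K v ≡ true
    K-v rewrite dec-true (v ≟ v) refl = refl
    K-≢ : ∀ u → u ≢ v → K u ≡ R u
    K-≢ u u≢v rewrite dec-false (u ≟ v) u≢v = refl

    size : degree G v ≡ count K
    size = trans (degree≡count G v)
                 (trans (count-insert c vc R-c R-≢) (sym (count-insert v K-v R-v K-≢)))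

    R-members : ∀ u → R u ≡ true → u ≢ c × Neighbour u
    R-members u Ru = u≢c , trans (R-≢ u u≢c) Ru
      where
      u≢c : u ≢ c
      u≢c u≡c = contradiction (trans (sym Ru) (trans (cong R u≡c) R-c)) λ ()

    K-members : ∀ u → K u ≡ true → u ≡ v ⊎ (u ≢ c × Neighbour u)
    K-members u Ku =
      Sum.map id (λ u≢v → R-members u (trans (sym (K-≢ u u≢v)) Ku)) (toSum (u ≟ v))

    pairwise : ∀ a b → K a ≡ true → K b ≡ true → a ≢ b → adj G a b ≡ true
    pairwise a b Ka Kb a≢b with K-members a Ka | K-members b Kb
    ... | inj₁ refl | inj₁ refl = contradiction refl a≢b
    ... | inj₁ refl | inj₂ (_ , vb) = vb
    ... | inj₂ (_ , va) | inj₁ refl = trans (symm G a v) va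
    ... | inj₂ (a≢c , va) | inj₂ (b≢c , vb) with adj G a b in ab
    ...   | true  = refl
    ...   | false = contradiction (a , b , (va , vb , a≢b , ab) , a≢c , b≢c) ¬avoid

  clique-of-degree : HasClique G (degree G v)
  clique-of-degree with any? (λ a → any? λ b → nonEdge? a b)
  ... | yes (a , b , ab@(va , vb , _)) with non-edges-share-vertex ab
  ...   | inj₁ ¬avoid-a = clique-around a va ¬avoid-a
  ...   | inj₂ ¬avoid-b = clique-around b vb ¬avoid-b
  clique-of-degree | no no-non-edge =
    subst (HasClique G) (sym (degree≡count G v)) (clique-of-set G (adj G v) pairwise)
    where
    pairwise : ∀ a b → adj G v a ≡ true → adj G v b ≡ true → a ≢ b → adj G a b ≡ true
    pairwise a b va vb a≢b with adj G a b in ab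
    ... | true  = refl
    ... | false = contradiction (a , b , va , vb , a≢b , ab) no-non-edge

induced-free : {G : Graph n} {f : Fin m → Fin n} → Injective _≡_ _≡_ f →
               ¬ HasForbidden G → ¬ HasForbidden (induced G f)
induced-free {G = G} f-inj free = free ∘ HasForbidden-↪ (induced-↪ G f-inj)

Δ≤clique-bound : {G : Graph n} → ¬ HasForbidden G → (∀ s → HasClique G s → s ≤ q) → Δ G ≤ q
Δ≤clique-bound {G = G} free bound =
  Δ-lub G λ v → bound _ (Neighbourhood.clique-of-degree G v free)

free⇒InΩ₁ : {G : Graph n} → ¬ HasForbidden G → InΩ 1 G
free⇒InΩ₁ free m f f-inj w (_ , ω-max) =
  +-monoˡ-≤ 1 (Δ≤clique-bound (induced-free f-inj free) ω-max)

free⇒InΥ₁ : {G : Graph n} → ¬ HasForbidden G → InΥ 1 G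
free⇒InΥ₁ {G = G} free m f f-inj c (col , _) =
  +-monoˡ-≤ 1 (Δ≤clique-bound (induced-free f-inj free)
                               λ _ K → clique≤colours {G = induced G f} K col)

-- Claw, gem, W₄ and butterfly

Δ>ω=χ⇒∉ : (T : Graph p) → HasClique T q → Colourable T q → q < Δ T →
          (H : Graph m) → H ≅ T → ¬ InΥ 1 H × ¬ InΩ 1 H
Δ>ω=χ⇒∉ {p = p} {q = q} T K col q<Δ H H≅T with ≅-sym {G = H} {H = T} H≅T
... | ψ , (ψ-inj , _) , ψ-adj =
  (λ inΥ → too-dense (inΥ p ψ ψ-inj q (proj₂ tight))) ,
  (λ inΩ → too-dense (inΩ p ψ ψ-inj q (proj₁ tight)))
  where
  H∘ψ≈T : induced H ψ ≈ T
  H∘ψ≈T = ψ-adj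
  T≈H∘ψ : T ≈ induced H ψ
  T≈H∘ψ = ≈-sym {G = induced H ψ} {T} H∘ψ≈T
  tight : IsCliqueNumber (induced H ψ) q × IsChromaticNumber (induced H ψ) q
  tight = ω≡χ≡ {G = induced H ψ} (HasClique-cong {G = T} {induced H ψ} T≈H∘ψ K)
                                 (Colourable-cong {G = T} {induced H ψ} T≈H∘ψ col)
  too-dense : ¬ (Δ (induced H ψ) + 1 ≤ q + 1)
  too-dense Δ≤ = <⇒≱ q<Δ (subst (_≤ q) (Δ-cong {G = induced H ψ} {T} H∘ψ≈T)
                                       (+-cancelʳ-≤ 1 (Δ (induced H ψ)) q Δ≤))

decide-clique : (G : Graph n) (K : Fin s → Fin n) →
                True (injective? K ×-dec
                      all? λ i → all? λ j → ¬? (i ≟ j) →-dec adj G (K i) (K j) ≟ᵇ true) →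
                HasClique G s
decide-clique G K ok = K , proj₁ (toWitness ok) , λ i j → proj₂ (toWitness ok) i j

decide-colouring : (G : Graph n) (col : Fin n → Fin q) →
                   True (all? λ i → all? λ j → adj G i j ≟ᵇ true →-dec ¬? (col i ≟ col j)) →
                   Colourable G q
decide-colouring G col ok = col , toWitness ok

InFourSet⇒∉ : (G : Graph n) → InFourSet G → ¬ InΥ 1 G × ¬ InΩ 1 G
InFourSet⇒∉ G (inj₁ G≅claw) =
  Δ>ω=χ⇒∉ claw (decide-clique claw (# 0 ∷ # 1 ∷ []) _)
          (decide-colouring claw (# 0 ∷ # 1 ∷ # 1 ∷ # 1 ∷ []) _) ≤-refl G G≅claw
InFourSet⇒∉ G (inj₂ (inj₁ G≅gem)) =
  Δ>ω=χ⇒∉ gem (decide-clique gem (# 4 ∷ # 0 ∷ # 1 ∷ []) _)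
          (decide-colouring gem (# 0 ∷ # 1 ∷ # 0 ∷ # 1 ∷ # 2 ∷ []) _) ≤-refl G G≅gem
InFourSet⇒∉ G (inj₂ (inj₂ (inj₁ G≅W4))) =
  Δ>ω=χ⇒∉ W4 (decide-clique W4 (# 4 ∷ # 0 ∷ # 1 ∷ []) _)
          (decide-colouring W4 (# 0 ∷ # 1 ∷ # 0 ∷ # 1 ∷ # 2 ∷ []) _) ≤-refl G G≅W4
InFourSet⇒∉ G (inj₂ (inj₂ (inj₂ G≅butterfly))) =
  Δ>ω=χ⇒∉ butterfly (decide-clique butterfly (# 0 ∷ # 1 ∷ # 2 ∷ []) _)
          (decide-colouring butterfly (# 0 ∷ # 1 ∷ # 2 ∷ # 1 ∷ # 2 ∷ []) _) ≤-refl G G≅butterfly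

-- A proper induced subgraph has fewer than five vertices, so the claw is all it could contain.
small⇒proper-induced-free : (T : Graph p) → p ≤ 5 → p ≤ 4 ⊎ ¬ claw ↪ T →
                           (G : Graph n) → G ≅ T → {f : Fin m → Fin n} → Injective _≡_ _≡_ f →
                           m < n → ¬ HasForbidden (induced G f)
small⇒proper-induced-free {p = p} {m = m} T p≤5 small-or-claw-free G G≅T {f} f-inj m<n = refute
  where
  G↪T : G ↪ T
  G↪T = ≅⇒↪ {G = G} {T} G≅T
  H↪T : induced G f ↪ T
  H↪T = ↪-trans (induced-↪ G f-inj) G↪T
  m<p : m < p
  m<p = <-≤-trans m<n (↪-size G↪T)
  no-five : {X : Graph 5} → ¬ X ↪ induced G f
  no-five X↪H = <⇒≱ (<-≤-trans m<p p≤5) (↪-size X↪H)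
  no-claw : ¬ claw ↪ induced G f
  no-claw claw↪H = Sum.[ (λ p≤4 → <⇒≱ (<-≤-trans m<p p≤4) (↪-size claw↪H))
                        , (λ claw-free → claw-free (↪-trans claw↪H H↪T)) ] small-or-claw-free
  refute : ¬ HasForbidden (induced G f)
  refute (inj₁ claw↪H)                   = no-claw claw↪H
  refute (inj₂ (inj₁ gem↪H))             = no-five gem↪H
  refute (inj₂ (inj₂ (inj₁ W4↪H)))       = no-five W4↪H
  refute (inj₂ (inj₂ (inj₂ butterfly↪H))) = no-five butterfly↪H

proper-induced-free : (G : Graph n) → InFourSet G → {f : Fin m → Fin n} → Injective _≡_ _≡_ f →
                      m < n → ¬ HasForbidden (induced G f)
proper-induced-free G (inj₁ G≅claw) =
  small⇒proper-induced-free claw (n≤1+n 4) (inj₁ ≤-refl) G G≅claw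
proper-induced-free G (inj₂ (inj₁ G≅gem)) =
  small⇒proper-induced-free gem ≤-refl
    (inj₂ (toWitnessFalse {a? = claw ↪? gem} _)) G G≅gem
proper-induced-free G (inj₂ (inj₂ (inj₁ G≅W4))) =
  small⇒proper-induced-free W4 ≤-refl
    (inj₂ (toWitnessFalse {a? = claw ↪? W4} _)) G G≅W4
proper-induced-free G (inj₂ (inj₂ (inj₂ G≅butterfly))) =
  small⇒proper-induced-free butterfly ≤-refl
    (inj₂ (toWitnessFalse {a? = claw ↪? butterfly} _)) G G≅butterfly

module Characterisation
  (P : ∀ {n} → Graph n → Set)
  (free⇒P : ∀ {n} {G : Graph n} → ¬ HasForbidden G → P G)
  (four∉P : ∀ {n} (G : Graph n) → InFourSet G → ¬ P G)
  where

  InFourSet⇒minimal : (G : Graph n) → InFourSet G → MinimalForbidden P G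
  InFourSet⇒minimal G four =
    four∉P G four , λ _ _ f-inj m<n → free⇒P (proper-induced-free G four f-inj m<n)

  -- A forbidden graph inside a minimal G must be all of G.
  embedded⇒InFourSet : {X : Graph k} {G : Graph n} → MinimalForbidden P G →
                       (∀ {m} (H : Graph m) → H ≅ X → InFourSet H) → X ↪ G → InFourSet G
  embedded⇒InFourSet {k = k} {n = n} {G = G} (_ , proper∈P) ≅X⇒four e with k <? n
  ... | yes k<n = contradiction (proper∈P k (emb e) (_↪_.emb-injective e) k<n)
                                (four∉P _ (≅X⇒four (induced G (emb e)) (↪⇒induced≅ e)))
  ... | no  k≮n = ≅X⇒four G (≅-of-equal-size (≤-antisym (↪-size e) (≮⇒≥ k≮n)) e)

  minimal⇒InFourSet : (G : Graph n) → MinimalForbidden P G → InFourSet G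
  minimal⇒InFourSet G minimal@(G∉P , _) =
    classify (decidable-stable (hasForbidden? G) λ free → G∉P (free⇒P free))
    where
    classify : HasForbidden G → InFourSet G
    classify (inj₁ e)               = embedded⇒InFourSet minimal (λ _ → inj₁) e
    classify (inj₂ (inj₁ e))        = embedded⇒InFourSet minimal (λ _ → inj₂ ∘ inj₁) e
    classify (inj₂ (inj₂ (inj₁ e))) = embedded⇒InFourSet minimal (λ _ → inj₂ ∘ inj₂ ∘ inj₁) e
    classify (inj₂ (inj₂ (inj₂ e))) = embedded⇒InFourSet minimal (λ _ → inj₂ ∘ inj₂ ∘ inj₂) e

  minimal⇔InFourSet : (G : Graph n) → MinimalForbidden P G ⇔ InFourSet G
  minimal⇔InFourSet G = mk⇔ (minimal⇒InFourSet G) (InFourSet⇒minimal G)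

theorem5 : (∀ {n} (G : Graph n) → MinimalForbidden (InΥ 1) G ⇔ InFourSet G)
         × (∀ {n} (G : Graph n) → MinimalForbidden (InΩ 1) G ⇔ InFourSet G)
theorem5 = Υ₁.minimal⇔InFourSet , Ω₁.minimal⇔InFourSet
  where
  module Υ₁ = Characterisation (InΥ 1) free⇒InΥ₁ (λ G four → proj₁ (InFourSet⇒∉ G four))
  module Ω₁ = Characterisation (InΩ 1) free⇒InΩ₁ (λ G four → proj₂ (InFourSet⇒∉ G four))
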